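{- Let $G=(V,E)$ be an undirected graph and let $(S,T)$ be a valid pair of spanning $2$-matchings of $G$. If $S$ contains a cycle $C$, then $C$ contains two edges $e_1,e_2$ such that, with $S_i=S\setminus\{e_i\}$ and $T_i=T\cup\{e_i\}$ for $i=1,2$, the following hold: (1) $(S_i,T_i)$ is valid for $i=1,2$; (2) $V_1(S_i)\cup V_1(T_i)=V_1(S)\cup V_1(T)$ and $V_1(S_i)\cap V_1(T_i)=V_1(S)\cap V_1(T)$ for $i=1,2$; (3) $\mathcal{P}(T)$ contains a path $P$ such that $P\cup\{e_1\}$ and $P\cup\{e_2\}$ are both paths.
   Context: Edge sets are identified with subgraphs. For $F\subseteq E$, $V(F)$ is the set of vertices incident to some edge of $F$; $F$ is spanning if $V(F)=V$, and acyclic if it contains no cycle. $F$ is a $2$-matching if every vertex is incident to at most two edges of $F$. $V_1(F)$ and $V_2(F)$ denote the sets of vertices incident to exactly one, resp. exactly two, edges of $F$, and $\delta_F(v)$ is the set of edges of $F$ incident to $v$. An acyclic $2$-matching $F$ is a vertex-disjoint union of paths; $\mathcal{P}(F)$ denotes this family of paths (each path an edge set). A pair $(S,T)$ of spanning $2$-matchings is valid if (i) $T$ is acyclic, (ii) $\delta_S(v)=\delta_T(v)$ for every $v\in V_2(S)\cap V_2(T)$, and (iii) $V(C)\neq V(P)$ for every cycle $C\subseteq S$ and every path $P\in\mathcal{P}(T)$. -}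

module Defs where

open import Data.Nat using (ℕ; _≤_; _≥_)
open import Data.Bool using (Bool; _∨_)
open import Data.Fin using (Fin; _≟_)
open import Data.Fin.Subset public
  using (Subset; _∈_; _⊆_; _∩_; _∪_; _-_; ⁅_⁆; ∣_∣; Nonempty)
open import Data.Vec using (tabulate)
open import Data.Product using (Σ; ∃; _×_; _,_)
open import Data.Sum using (_⊎_)
open import Relation.Nullary using (¬_; does)
open import Relation.Binary.PropositionalEquality using (_≡_; _≢_)
open import Relation.Binary.Construct.Closure.ReflexiveTransitive using (Star)

record Graph (n m : ℕ) : Set where
  field
    end₁ end₂ : Fin m → Fin n
    loopless  : ∀ e → end₁ e ≢ end₂ e
    simple    : ∀ e f →
                (end₁ e ≡ end₁ f × end₂ e ≡ end₂ f)
                ⊎ (end₁ e ≡ end₂ f × end₂ e ≡ end₁ f) → e ≡ f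

EdgeSet : ℕ → Set
EdgeSet m = Subset m

_≐_ : ∀ {n} → (Fin n → Set) → (Fin n → Set) → Set
A ≐ B = ∀ v → (A v → B v) × (B v → A v)

module _ {n m : ℕ} (G : Graph n m) where
  open Graph G

  inc : Fin n → EdgeSet m
  inc v = tabulate (λ e → does (end₁ e ≟ v) ∨ does (end₂ e ≟ v))

  δ : EdgeSet m → Fin n → EdgeSet m
  δ F v = F ∩ inc v

  deg : EdgeSet m → Fin n → ℕ
  deg F v = ∣ δ F v ∣

  VS : EdgeSet m → Fin n → Set
  VS F v = deg F v ≥ 1

  V₁ : EdgeSet m → Fin n → Set
  V₁ F v = deg F v ≡ 1

  V₂ : EdgeSet m → Fin n → Set
  V₂ F v = deg F v ≡ 2

  Spanning : EdgeSet m → Set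
  Spanning F = ∀ v → VS F v

  Is2Matching : EdgeSet m → Set
  Is2Matching F = ∀ v → deg F v ≤ 2

  Adj : EdgeSet m → Fin n → Fin n → Set
  Adj F u v = ∃ λ e → e ∈ F × ((end₁ e ≡ u × end₂ e ≡ v) ⊎ (end₂ e ≡ u × end₁ e ≡ v))

  Connected : EdgeSet m → Set
  Connected F = ∀ u v → VS F u → VS F v → Star (Adj F) u v

  IsCycle : EdgeSet m → Set
  IsCycle C = Nonempty C × Connected C × (∀ v → VS C v → V₂ C v)

  Acyclic : EdgeSet m → Set
  Acyclic F = ∀ C → C ⊆ F → ¬ IsCycle C

  IsPath : EdgeSet m → Set
  IsPath P = Nonempty P × Connected P × Acyclic P × Is2Matching P

  -- P ∈ 𝒫(F): P is a connected component (with at least one edge) of F;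
  -- for acyclic 2-matchings F these are exactly the paths of F.
  InPaths : EdgeSet m → EdgeSet m → Set
  InPaths F P = P ⊆ F × Nonempty P × Connected P
              × (∀ e → e ∈ F → ∀ v → e ∈ inc v → VS P v → e ∈ P)

  Valid : EdgeSet m → EdgeSet m → Set
  Valid S T =
      (Spanning S × Is2Matching S)
    × (Spanning T × Is2Matching T)
    × Acyclic T
    × (∀ v → V₂ S v → V₂ T v → δ S v ≡ δ T v)
    × (∀ C → C ⊆ S → IsCycle C → ∀ P → InPaths T P → ¬ (VS C ≐ VS P))

-- Pick e₀ ∈ C ∖ T (T is acyclic) and let P be the path of T through an end of e₀. Call an edge
-- of C a boundary edge if exactly one of its ends lies in V(P). A boundary edge e is not in T and
-- its ends have degree 2 in S and 1 in T, so moving e from S to T keeps the pair valid, leaves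
-- V₁(S) ∪ V₁(T) and V₁(S) ∩ V₁(T) unchanged and extends P to the path P ∪ {e}; T ∪ {e} stays
-- acyclic because a cycle through e would have to leave V(P) a second time, along an edge of T.
-- By the handshake lemma a cycle crosses a vertex cut an even number of times, so one boundary
-- edge yields two. If there were none, V(C) ⊆ V(P): a second edge of C ∖ T would give the path P
-- three leaves, and otherwise C ∖ {e₀} ⊆ T forces V(C) = V(P), against validity.
module Submission where

open import Defs
open import Data.Nat using (ℕ)
open import Data.Fin using (Fin)
open import Data.Product using (Σ; ∃; _×_; _,_)
open import Data.Sum using (_⊎_)
open import Relation.Binary.PropositionalEquality using (_≡_; _≢_)

open import Data.Nat.Base using (zero; suc; _+_; _*_; _≤_; _<_; z≤n; s≤s)
open import Data.Nat.Properties hiding (_≟_)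
open import Data.Nat.Properties using () renaming (_≟_ to _≟ℕ_)
open import Data.Nat.Divisibility using (_∣_; ∣m∣n⇒∣m+n; ∣m+n∣m⇒∣n; ∣1⇒≡1; n∣m*n; _∣0; ∣-refl)
open import Data.Bool.Base using (Bool; true; false; _∧_)
open import Data.Fin.Base using (zero; suc; punchIn)
open import Data.Fin.Properties using (_≟_; any?; punchInᵢ≢i)
open import Data.Fin.Subset renaming (⊥ to ∅)
open import Data.Fin.Subset.Properties
open import Data.Vec.Base using ([]; _∷_; lookup; tabulate; here; there)
open import Data.Vec.Properties using (lookup∘tabulate; lookup-zipWith; []=⇒lookup; lookup⇒[]=)
open import Data.Product using (∃₂; proj₁; proj₂; uncurry)
open import Data.Sum as Sum using (inj₁; inj₂; [_,_]′; map₁)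
open import Data.Empty using (⊥; ⊥-elim)
open import Function.Base using (_∘_)
open import Relation.Nullary using (¬_; yes; no; does; contradiction; ¬?)
open import Relation.Nullary.Decidable using (dec-true; decidable-stable; _×-dec_; _⊎-dec_)
open import Relation.Unary using (Decidable)
open import Relation.Binary.Core using (Rel)
open import Relation.Binary.PropositionalEquality
open import Relation.Binary.Construct.Closure.ReflexiveTransitive as Star using (Star; ε; _◅_; _◅◅_; reverse)
open import Algebra.Properties.Semiring.Sum +-*-semiring
  using (sum; sum-remove; sum-cong-≗; ∑-comm; ∑-distrib-+; *-distribˡ-sum; *-distribʳ-sum)

private variable
  k : ℕ
  p q : Subset k
  x y : Fin k

∣p∣≡suc∣p-x∣ : x ∈ p → ∣ p ∣ ≡ suc ∣ p - x ∣
∣p∣≡suc∣p-x∣ {x = zero}  {p = inside  ∷ p} here        = cong (λ r → suc ∣ r ∣) (sym (p─⊥≡p p))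
∣p∣≡suc∣p-x∣ {x = suc x} {p = inside  ∷ p} (there x∈p) = cong suc (∣p∣≡suc∣p-x∣ x∈p)
∣p∣≡suc∣p-x∣ {x = suc x} {p = outside ∷ p} (there x∈p) = ∣p∣≡suc∣p-x∣ x∈p

∣p∪⁅x⁆∣≡suc∣p∣ : x ∉ p → ∣ p ∪ ⁅ x ⁆ ∣ ≡ suc ∣ p ∣
∣p∪⁅x⁆∣≡suc∣p∣ {x = zero}  {p = inside  ∷ p} x∉p = contradiction here x∉p
∣p∪⁅x⁆∣≡suc∣p∣ {x = zero}  {p = outside ∷ p} x∉p = cong (λ r → suc ∣ r ∣) (∪-identityʳ p)
∣p∪⁅x⁆∣≡suc∣p∣ {x = suc x} {p = inside  ∷ p} x∉p = cong suc (∣p∪⁅x⁆∣≡suc∣p∣ (x∉p ∘ there))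
∣p∪⁅x⁆∣≡suc∣p∣ {x = suc x} {p = outside ∷ p} x∉p = ∣p∪⁅x⁆∣≡suc∣p∣ (x∉p ∘ there)

x∈p⇒1≤∣p∣ : x ∈ p → 1 ≤ ∣ p ∣
x∈p⇒1≤∣p∣ x∈p rewrite ∣p∣≡suc∣p-x∣ x∈p = s≤s z≤n

Empty⇒∣p∣≡0 : Empty p → ∣ p ∣ ≡ 0
Empty⇒∣p∣≡0 {k} empty = trans (cong ∣_∣ (Empty-unique empty)) (∣⊥∣≡0 k)

1≤∣p∣⇒Nonempty : 1 ≤ ∣ p ∣ → Nonempty p
1≤∣p∣⇒Nonempty {p = p} 1≤∣p∣ with nonempty? p
... | yes nonempty = nonempty
... | no  empty    = contradiction (subst (1 ≤_) (Empty⇒∣p∣≡0 empty) 1≤∣p∣) λ ()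

x∈p─q⇒x∉q : ∀ (p q : Subset k) → x ∈ p ─ q → x ∉ q
x∈p─q⇒x∉q (_ ∷ p)      (inside ∷ q)  (there x∈) (there x∈q) = x∈p─q⇒x∉q p q x∈ x∈q
x∈p─q⇒x∉q (_ ∷ p)      (outside ∷ q) (there x∈) (there x∈q) = x∈p─q⇒x∉q p q x∈ x∈q
x∈p─q⇒x∉q (inside ∷ p) (outside ∷ q) here       ()

x∈p-y⇒x≢y : x ∈ p - y → x ≢ y
x∈p-y⇒x≢y {p = p} {y = y} x∈ refl = x∈p─q⇒x∉q p ⁅ y ⁆ x∈ (x∈⁅x⁆ y)

x∈p-y⇒x∈p : x ∈ p - y → x ∈ p
x∈p-y⇒x∈p {p = p} {y = y} = p─q⊆p p ⁅ y ⁆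

x∈p∪⁅y⁆⁻ : x ∈ p ∪ ⁅ y ⁆ → x ∈ p ⊎ x ≡ y
x∈p∪⁅y⁆⁻ {p = p} {y = y} x∈ with x∈p∪q⁻ p ⁅ y ⁆ x∈
... | inj₁ x∈p = inj₁ x∈p
... | inj₂ x∈y = inj₂ (x∈⁅y⁆⇒x≡y y x∈y)

x∈p∪⁅y⁆∧x≢y⇒x∈p : x ∈ p ∪ ⁅ y ⁆ → x ≢ y → x ∈ p
x∈p∪⁅y⁆∧x≢y⇒x∈p {p = p} x∈ x≢y with x∈p∪⁅y⁆⁻ {p = p} x∈
... | inj₁ x∈p = x∈p
... | inj₂ x≡y = contradiction x≡y x≢y

x∈p∪⁅y⁆⁺ : x ∈ p ⊎ x ≡ y → x ∈ p ∪ ⁅ y ⁆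
x∈p∪⁅y⁆⁺ (inj₁ x∈p) = x∈p∪q⁺ (inj₁ x∈p)
x∈p∪⁅y⁆⁺ {y = y} (inj₂ refl) = x∈p∪q⁺ (inj₂ (x∈⁅x⁆ y))

∣p∣≡1⇒x≡y : ∣ p ∣ ≡ 1 → x ∈ p → y ∈ p → x ≡ y
∣p∣≡1⇒x≡y {x = x} {y} ∣p∣≡1 x∈p y∈p with x ≟ y
... | yes x≡y = x≡y
... | no  x≢y = contradiction (subst (1 ≤_) ∣p-x∣≡0 (x∈p⇒1≤∣p∣ (x∈p∧x≢y⇒x∈p-y y∈p (x≢y ∘ sym)))) λ ()
  where ∣p-x∣≡0 = suc-injective (trans (sym (∣p∣≡suc∣p-x∣ x∈p)) ∣p∣≡1)

∣p∣≡2⇒∃≢ : ∣ p ∣ ≡ 2 → ∀ x → ∃ λ y → y ∈ p × y ≢ x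
∣p∣≡2⇒∃≢ {p = p} ∣p∣≡2 x with x ∈? p
... | no x∉p = let y , y∈p = 1≤∣p∣⇒Nonempty (subst (1 ≤_) (sym ∣p∣≡2) (s≤s z≤n)) in
               y , y∈p , λ { refl → x∉p y∈p }
... | yes x∈p with 1≤∣p∣⇒Nonempty (≤-reflexive (suc-injective (trans (sym ∣p∣≡2) (∣p∣≡suc∣p-x∣ x∈p))))
...   | y , y∈ = y , x∈p-y⇒x∈p {p = p} y∈ , x∈p-y⇒x≢y {p = p} y∈

p⊆q∧∣q∣≤∣p∣⇒q⊆p : p ⊆ q → ∣ q ∣ ≤ ∣ p ∣ → q ⊆ p
p⊆q∧∣q∣≤∣p∣⇒q⊆p {p = p} p⊆q ∣q∣≤∣p∣ {x} x∈q with x ∈? p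
... | yes x∈p = x∈p
... | no  x∉p = contradiction ∣q∣≤∣p∣ (<⇒≱ (p⊂q⇒∣p∣<∣q∣ (p⊆q , x , x∈q , x∉p)))

p⊈q⇒∃∉ : ¬ p ⊆ q → ∃ λ x → x ∈ p × x ∉ q
p⊈q⇒∃∉ {p = p} {q} p⊈q with any? (λ x → x ∈? p ×-dec ¬? (x ∈? q))
... | yes found = found
... | no none   = contradiction (λ {x} x∈p → decidable-stable (x ∈? q) λ x∉q → none (x , x∈p , x∉q)) p⊈q

select : {Q : Fin k → Set} → Decidable Q → Subset k
select Q? = tabulate (λ x → does (Q? x))

∈-select⁺ : {Q : Fin k → Set} (Q? : Decidable Q) → Q x → x ∈ select Q?
∈-select⁺ {x = x} Q? qx = lookup⇒[]= x (select Q?) (trans (lookup∘tabulate _ x) (dec-true (Q? x) qx))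

∈-select⁻ : {Q : Fin k → Set} (Q? : Decidable Q) → x ∈ select Q? → Q x
∈-select⁻ {x = x} Q? x∈ with Q? x | trans (sym (lookup∘tabulate (λ y → does (Q? y)) x)) ([]=⇒lookup x∈)
... | yes qx | _ = qx
... | no _   | ()

𝟙 : Bool → ℕ
𝟙 true  = 1
𝟙 false = 0

𝟙-∧ : ∀ a b → 𝟙 (a ∧ b) ≡ 𝟙 a * 𝟙 b
𝟙-∧ true  b = sym (+-identityʳ (𝟙 b))
𝟙-∧ false b = refl

∣p∣≡∑𝟙 : (p : Subset k) → ∣ p ∣ ≡ sum (λ x → 𝟙 (lookup p x))
∣p∣≡∑𝟙 []            = refl
∣p∣≡∑𝟙 (inside ∷ p)  = cong suc (∣p∣≡∑𝟙 p)
∣p∣≡∑𝟙 (outside ∷ p) = ∣p∣≡∑𝟙 p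

∣select∣≡∑𝟙 : {Q : Fin k → Set} (Q? : Decidable Q) → ∣ select Q? ∣ ≡ sum (λ x → 𝟙 (does (Q? x)))
∣select∣≡∑𝟙 Q? = trans (∣p∣≡∑𝟙 (select Q?))
  (sum-cong-≗ (λ x → cong 𝟙 (lookup∘tabulate (λ y → does (Q? y)) x)))

3≤∣p∣ : ∀ {z} → x ∈ p → y ∈ p → z ∈ p → x ≢ y → x ≢ z → y ≢ z → 3 ≤ ∣ p ∣
3≤∣p∣ {p = p} x∈p y∈p z∈p x≢y x≢z y≢z
  rewrite ∣p∣≡suc∣p-x∣ x∈p | ∣p∣≡suc∣p-x∣ (x∈p∧x≢y⇒x∈p-y y∈p (x≢y ∘ sym))
  = s≤s (s≤s (x∈p⇒1≤∣p∣ (x∈p∧x≢y⇒x∈p-y (x∈p∧x≢y⇒x∈p-y z∈p (x≢z ∘ sym)) (y≢z ∘ sym))))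

∑-pres-∣ : ∀ {d} (f : Fin k → ℕ) → (∀ x → d ∣ f x) → d ∣ sum f
∑-pres-∣ {zero}  {d} f _ = d ∣0
∑-pres-∣ {suc k} f d∣f = ∣m∣n⇒∣m+n (d∣f zero) (∑-pres-∣ (λ x → f (suc x)) (λ x → d∣f (suc x)))

∣∑⇒∣ : ∀ {d} (f : Fin k → ℕ) (z : Fin k) → (∀ x → x ≢ z → d ∣ f x) → d ∣ sum f → d ∣ f z
∣∑⇒∣ {suc k} {d} f z d∣others d∣∑ =
  ∣m+n∣m⇒∣n (subst (d ∣_) (trans (sum-remove {i = z} f) (+-comm (f z) _)) d∣∑)
             (∑-pres-∣ (λ x → f (punchIn z x)) (λ x → d∣others (punchIn z x) (punchInᵢ≢i z x)))

2∤suc : ∀ {r} → 2 ∣ r → ¬ 2 ∣ suc r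
2∤suc {r} 2∣r 2∣1+r = contradiction (∣1⇒≡1 (∣m+n∣m⇒∣n (subst (2 ∣_) (+-comm 1 r) 2∣1+r) 2∣r)) λ ()

Star-pres : ∀ {ℓ} {A : Set} {R : Rel A ℓ} (Q : A → Set) → (∀ {y z} → Q y → R y z → Q z) →
            ∀ {a b} → Q a → Star R a b → Q b
Star-pres Q pres qa ε        = qa
Star-pres Q pres qa (r ◅ rs) = Star-pres Q pres (pres qa r) rs

Star-restrict : ∀ {ℓ ℓ′} {A : Set} {R : Rel A ℓ} {R′ : Rel A ℓ′} (Q : A → Set) →
                (∀ {y z} → Q y → R y z → Q z × R′ y z) →
                ∀ {a b} → Q a → Star R a b → Star R′ a b
Star-restrict Q step qa ε        = ε
Star-restrict Q step qa (r ◅ rs) = proj₂ (step qa r) ◅ Star-restrict Q step (proj₁ (step qa r)) rs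

module Incidence {n m : ℕ} (G : Graph n m) where
  open Graph G

  Joins : Fin m → Fin n → Fin n → Set
  Joins f u v = (end₁ f ≡ u × end₂ f ≡ v) ⊎ (end₂ f ≡ u × end₁ f ≡ v)

  inc⁻ : ∀ {f v} → f ∈ inc G v → end₁ f ≡ v ⊎ end₂ f ≡ v
  inc⁻ {v = v} = ∈-select⁻ (λ f → (end₁ f ≟ v) ⊎-dec (end₂ f ≟ v))

  inc⁺ : ∀ {f v} → end₁ f ≡ v ⊎ end₂ f ≡ v → f ∈ inc G v
  inc⁺ {v = v} = ∈-select⁺ (λ f → (end₁ f ≟ v) ⊎-dec (end₂ f ≟ v))

  Joins-sym : ∀ {f u v} → Joins f u v → Joins f v u
  Joins-sym (inj₁ (p , q)) = inj₂ (q , p)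
  Joins-sym (inj₂ (p , q)) = inj₁ (q , p)

  Joins-inc₁ : ∀ {f u v} → Joins f u v → f ∈ inc G u
  Joins-inc₁ (inj₁ (p , _)) = inc⁺ (inj₁ p)
  Joins-inc₁ (inj₂ (p , _)) = inc⁺ (inj₂ p)

  Joins-inc₂ : ∀ {f u v} → Joins f u v → f ∈ inc G v
  Joins-inc₂ = Joins-inc₁ ∘ Joins-sym

  Joins-from-inc : ∀ {f u} → f ∈ inc G u → ∃ (Joins f u)
  Joins-from-inc {f} f∈ with inc⁻ f∈
  ... | inj₁ p = end₂ f , inj₁ (p , refl)
  ... | inj₂ p = end₁ f , inj₂ (p , refl)

  Joins-inc⁻ : ∀ {f u v w} → Joins f u v → f ∈ inc G w → w ≡ u ⊎ w ≡ v
  Joins-inc⁻ (inj₁ (p , q)) f∈ with inc⁻ f∈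
  ... | inj₁ r = inj₁ (trans (sym r) p)
  ... | inj₂ r = inj₂ (trans (sym r) q)
  Joins-inc⁻ (inj₂ (p , q)) f∈ with inc⁻ f∈
  ... | inj₁ r = inj₂ (trans (sym r) q)
  ... | inj₂ r = inj₁ (trans (sym r) p)

  Joins-injective : ∀ {f g u v} → Joins f u v → Joins g u v → f ≡ g
  Joins-injective (inj₁ (p , q)) (inj₁ (r , s)) = simple _ _ (inj₁ (trans p (sym r) , trans q (sym s)))
  Joins-injective (inj₁ (p , q)) (inj₂ (r , s)) = simple _ _ (inj₂ (trans p (sym r) , trans q (sym s)))
  Joins-injective (inj₂ (p , q)) (inj₁ (r , s)) = simple _ _ (inj₂ (trans q (sym s) , trans p (sym r)))
  Joins-injective (inj₂ (p , q)) (inj₂ (r , s)) = simple _ _ (inj₁ (trans q (sym s) , trans p (sym r)))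

  distinct-edge-new-end : ∀ {e f u v} → Joins e u v → f ≢ e → ∃ λ w → f ∈ inc G w × w ≢ u × w ≢ v
  distinct-edge-new-end {e} {f} {u} {v} e-uv f≢e with end₁ f ≟ u | end₁ f ≟ v
  ... | no ≢u    | no ≢v    = end₁ f , inc⁺ (inj₁ refl) , ≢u , ≢v
  ... | yes refl | _        = end₂ f , inc⁺ (inj₂ refl) , loopless f ∘ sym
                              , λ { refl → f≢e (Joins-injective (inj₁ (refl , refl)) e-uv) }
  ... | no _     | yes refl = end₂ f , inc⁺ (inj₂ refl)
                              , (λ { refl → f≢e (Joins-injective (inj₂ (refl , refl)) e-uv) }) , loopless f ∘ sym

  Adj-sym : ∀ {F u v} → Adj G F u v → Adj G F v u
  Adj-sym (f , f∈F , f-uv) = f , f∈F , Joins-sym f-uv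

  Adj-mono : ∀ {F F′ u v} → F ⊆ F′ → Adj G F u v → Adj G F′ u v
  Adj-mono F⊆F′ (f , f∈F , f-uv) = f , F⊆F′ f∈F , f-uv

  connected-from : ∀ {F u} → (∀ {w} → VS G F w → Star (Adj G F) u w) → Connected G F
  connected-from walk v w v∈ w∈ = reverse Adj-sym (walk v∈) ◅◅ walk w∈

  ∈δ⁻ : ∀ {F f v} → f ∈ δ G F v → f ∈ F × f ∈ inc G v
  ∈δ⁻ {F} {v = v} = x∈p∩q⁻ F (inc G v)

  ∈δ⁺ : ∀ {F f v} → f ∈ F → f ∈ inc G v → f ∈ δ G F v
  ∈δ⁺ f∈F f∈v = x∈p∩q⁺ (f∈F , f∈v)

  δ-mono : ∀ {F F′ v} → F ⊆ F′ → δ G F v ⊆ δ G F′ v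
  δ-mono F⊆F′ f∈ = let f∈F , f∈v = ∈δ⁻ f∈ in ∈δ⁺ (F⊆F′ f∈F) f∈v

  deg-mono : ∀ {F F′} v → F ⊆ F′ → deg G F v ≤ deg G F′ v
  deg-mono v F⊆F′ = p⊆q⇒∣p∣≤∣q∣ (δ-mono {v = v} F⊆F′)

  VS⁺ : ∀ {F f v} → f ∈ F → f ∈ inc G v → VS G F v
  VS⁺ f∈F f∈v = x∈p⇒1≤∣p∣ (∈δ⁺ f∈F f∈v)

  VS⁻ : ∀ {F v} → VS G F v → ∃ λ f → f ∈ F × f ∈ inc G v
  VS⁻ v∈ with 1≤∣p∣⇒Nonempty v∈
  ... | f , f∈ = f , ∈δ⁻ f∈

  δ-remove : ∀ {F e v} → δ G (F - e) v ≡ δ G F v - e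
  δ-remove {F} {e} {v} = ⊆-antisym
    (λ f∈ → let f∈F-e , f∈v = ∈δ⁻ {F - e} f∈ in
            x∈p∧x≢y⇒x∈p-y (∈δ⁺ (x∈p-y⇒x∈p {p = F} f∈F-e) f∈v) (x∈p-y⇒x≢y {p = F} f∈F-e))
    (λ f∈ → let f∈F , f∈v = ∈δ⁻ (x∈p-y⇒x∈p {p = δ G F v} f∈) in
            ∈δ⁺ (x∈p∧x≢y⇒x∈p-y f∈F (x∈p-y⇒x≢y {p = δ G F v} f∈)) f∈v)

  δ-insert : ∀ {F e v} → e ∈ inc G v → δ G (F ∪ ⁅ e ⁆) v ≡ δ G F v ∪ ⁅ e ⁆
  δ-insert {F} {e} {v} e∈v = ⊆-antisym
    (λ f∈ → let f∈F∪e , f∈v = ∈δ⁻ {F ∪ ⁅ e ⁆} f∈ in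
            x∈p∪⁅y⁆⁺ (map₁ (λ f∈F → ∈δ⁺ f∈F f∈v) (x∈p∪⁅y⁆⁻ {p = F} f∈F∪e)))
    (λ f∈ → [ (λ f∈δ → let f∈F , f∈v = ∈δ⁻ f∈δ in ∈δ⁺ (x∈p∪⁅y⁆⁺ (inj₁ f∈F)) f∈v)
                     , (λ { refl → ∈δ⁺ (x∈p∪⁅y⁆⁺ (inj₂ refl)) e∈v }) ]′ (x∈p∪⁅y⁆⁻ {p = δ G F v} f∈))

  δ-unchanged : ∀ {F F′ e v} → e ∉ inc G v →
                (∀ {f} → f ≢ e → f ∈ F → f ∈ F′) → (∀ {f} → f ≢ e → f ∈ F′ → f ∈ F) → δ G F v ≡ δ G F′ v
  δ-unchanged {e = e} {v} e∉v F⊆F′ F′⊆F = ⊆-antisym (move F⊆F′) (move F′⊆F)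
    where
    move : ∀ {A B} → (∀ {f} → f ≢ e → f ∈ A → f ∈ B) → δ G A v ⊆ δ G B v
    move A⊆B f∈ = let f∈A , f∈v = ∈δ⁻ f∈ in ∈δ⁺ (A⊆B (λ { refl → e∉v f∈v }) f∈A) f∈v

  deg-remove : ∀ {F e v} → e ∈ F → e ∈ inc G v → deg G F v ≡ suc (deg G (F - e) v)
  deg-remove {F} {e} {v} e∈F e∈v =
    trans (∣p∣≡suc∣p-x∣ (∈δ⁺ e∈F e∈v)) (cong (λ p → suc ∣ p ∣) (sym (δ-remove {F} {e} {v})))

  deg-insert : ∀ {F e v} → e ∉ F → e ∈ inc G v → deg G (F ∪ ⁅ e ⁆) v ≡ suc (deg G F v)
  deg-insert {F} e∉F e∈v = trans (cong ∣_∣ (δ-insert {F} e∈v)) (∣p∪⁅x⁆∣≡suc∣p∣ (e∉F ∘ proj₁ ∘ ∈δ⁻))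

  deg-remove-nonincident : ∀ {F e v} → e ∉ inc G v → deg G (F - e) v ≡ deg G F v
  deg-remove-nonincident {F} e∉v =
    cong ∣_∣ (δ-unchanged e∉v (λ _ → x∈p-y⇒x∈p {p = F}) (λ f≢e f∈F → x∈p∧x≢y⇒x∈p-y f∈F f≢e))

  deg-insert-nonincident : ∀ {F e v} → e ∉ inc G v → deg G (F ∪ ⁅ e ⁆) v ≡ deg G F v
  deg-insert-nonincident {F} e∉v = cong ∣_∣ (δ-unchanged e∉v
    (λ f≢e f∈ → x∈p∪⁅y⁆∧x≢y⇒x∈p {p = F} f∈ f≢e)
    (λ _ f∈F → x∈p∪⁅y⁆⁺ (inj₁ f∈F)))

module Handshake {n m : ℕ} (G : Graph n m) where
  open Graph G
  open Incidence G

  endpoints : Fin m → Subset n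
  endpoints f = select (λ v → (end₁ f ≟ v) ⊎-dec (end₂ f ≟ v))

  ∣endpoints∣≡2 : ∀ f → ∣ endpoints f ∣ ≡ 2
  ∣endpoints∣≡2 f = begin
    ∣ endpoints f ∣                ≡⟨ cong ∣_∣ endpoints≡ ⟩
    ∣ ⁅ end₁ f ⁆ ∪ ⁅ end₂ f ⁆ ∣    ≡⟨ ∣p∪⁅x⁆∣≡suc∣p∣ (loopless f ∘ sym ∘ x∈⁅y⁆⇒x≡y (end₁ f)) ⟩
    suc ∣ ⁅ end₁ f ⁆ ∣             ≡⟨ cong suc (∣⁅x⁆∣≡1 (end₁ f)) ⟩
    2                              ∎
    where
    open ≡-Reasoning
    Q? = λ v → (end₁ f ≟ v) ⊎-dec (end₂ f ≟ v)
    endpoints≡ : endpoints f ≡ ⁅ end₁ f ⁆ ∪ ⁅ end₂ f ⁆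
    endpoints≡ = ⊆-antisym
      (λ v∈ → x∈p∪q⁺ (Sum.map (λ { refl → x∈⁅x⁆ _ }) (λ { refl → x∈⁅x⁆ _ }) (∈-select⁻ Q? v∈)))
      (λ v∈ → ∈-select⁺ Q? (Sum.map (sym ∘ x∈⁅y⁆⇒x≡y _) (sym ∘ x∈⁅y⁆⇒x≡y _) (x∈p∪q⁻ _ _ v∈)))

  deg≡∑ : ∀ F v → deg G F v ≡ sum (λ f → 𝟙 (lookup F f) * 𝟙 (lookup (endpoints f) v))
  deg≡∑ F v = trans (∣p∣≡∑𝟙 (δ G F v)) (sum-cong-≗ λ f → begin
    𝟙 (lookup (F ∩ inc G v) f)                     ≡⟨ cong 𝟙 (lookup-zipWith _∧_ f F (inc G v)) ⟩
    𝟙 (lookup F f ∧ lookup (inc G v) f)            ≡⟨ 𝟙-∧ (lookup F f) _ ⟩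
    𝟙 (lookup F f) * 𝟙 (lookup (inc G v) f)        ≡⟨ cong (λ b → 𝟙 (lookup F f) * 𝟙 b) incident≡ ⟩
    𝟙 (lookup F f) * 𝟙 (lookup (endpoints f) v)    ∎)
    where
    open ≡-Reasoning
    incident≡ : ∀ {f} → lookup (inc G v) f ≡ lookup (endpoints f) v
    incident≡ {f} = trans (lookup∘tabulate _ f) (sym (lookup∘tabulate _ v))

  handshake : ∀ F → sum (deg G F) ≡ ∣ F ∣ * 2
  handshake F = begin
    sum (deg G F)
      ≡⟨ sum-cong-≗ (deg≡∑ F) ⟩
    sum (λ v → sum (λ f → 𝟙 (lookup F f) * 𝟙 (lookup (endpoints f) v)))
      ≡⟨ ∑-comm (λ v f → 𝟙 (lookup F f) * 𝟙 (lookup (endpoints f) v)) ⟩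
    sum (λ f → sum (λ v → 𝟙 (lookup F f) * 𝟙 (lookup (endpoints f) v)))
      ≡⟨ sum-cong-≗ (λ f → *-distribˡ-sum (𝟙 (lookup F f)) (λ v → 𝟙 (lookup (endpoints f) v))) ⟨
    sum (λ f → 𝟙 (lookup F f) * sum (λ v → 𝟙 (lookup (endpoints f) v)))
      ≡⟨ sum-cong-≗ (λ f → cong (𝟙 (lookup F f) *_) (trans (sym (∣p∣≡∑𝟙 (endpoints f))) (∣endpoints∣≡2 f))) ⟩
    sum (λ f → 𝟙 (lookup F f) * 2)
      ≡⟨ *-distribʳ-sum 2 (λ f → 𝟙 (lookup F f)) ⟨
    sum (λ f → 𝟙 (lookup F f)) * 2
      ≡⟨ cong (_* 2) (∣p∣≡∑𝟙 F) ⟨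
    ∣ F ∣ * 2 ∎
    where open ≡-Reasoning

  cycle-even : ∀ {D} → IsCycle G D → ∀ v → 2 ∣ deg G D v
  cycle-even {D} (_ , _ , regular) v with 1 ≤? deg G D v
  ... | yes v∈VD = subst (2 ∣_) (sym (regular v v∈VD)) ∣-refl
  ... | no  v∉VD = subst (2 ∣_) (sym (n<1⇒n≡0 (≰⇒> v∉VD))) (2 ∣0)

  deg-even : ∀ {F} z → (∀ w → w ≢ z → 2 ∣ deg G F w) → 2 ∣ deg G F z
  deg-even {F} z others = ∣∑⇒∣ (deg G F) z others (subst (2 ∣_) (sym (handshake F)) (n∣m*n ∣ F ∣))

module Crossing {n m : ℕ} (G : Graph n m) where
  open Graph G
  open Incidence G
  open Handshake G

  Crosses : (Fin n → Set) → Fin m → Set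
  Crosses X f = (X (end₁ f) × ¬ X (end₂ f)) ⊎ (X (end₂ f) × ¬ X (end₁ f))

  crosses? : ∀ {X} → Decidable X → Decidable (Crosses X)
  crosses? X? f = (X? (end₁ f) ×-dec ¬? (X? (end₂ f))) ⊎-dec (X? (end₂ f) ×-dec ¬? (X? (end₁ f)))

  Crosses⁺ : ∀ {X f u v} → Joins f u v → X u → ¬ X v → Crosses X f
  Crosses⁺ (inj₁ (refl , refl)) Xu ¬Xv = inj₁ (Xu , ¬Xv)
  Crosses⁺ (inj₂ (refl , refl)) Xu ¬Xv = inj₂ (Xu , ¬Xv)

  Crosses⁻ : ∀ {X f} → Crosses X f → ∃₂ λ u v → Joins f u v × X u × ¬ X v
  Crosses⁻ {f = f} (inj₁ (Xu , ¬Xv)) = end₁ f , end₂ f , inj₁ (refl , refl) , Xu , ¬Xv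
  Crosses⁻ {f = f} (inj₂ (Xu , ¬Xv)) = end₂ f , end₁ f , inj₂ (refl , refl) , Xu , ¬Xv

  Closed : EdgeSet m → (Fin n → Set) → Set
  Closed F X = ∀ {f u v} → f ∈ F → Joins f u v → X u → X v

  ¬Crosses⇒Closed : ∀ {F X} → Decidable X → (∀ {f} → f ∈ F → ¬ Crosses X f) → Closed F X
  ¬Crosses⇒Closed X? none {v = v} f∈F j Xu with X? v
  ... | yes Xv  = Xv
  ... | no  ¬Xv = contradiction (Crosses⁺ j Xu ¬Xv) (none f∈F)

  Closed-Star : ∀ {F X} → Closed F X → ∀ {a b} → X a → Star (Adj G F) a b → X b
  Closed-Star {X = X} closed = Star-pres X (λ { Xy (f , f∈F , j) → closed f∈F j Xy })

  -- If e were the only crossing edge, the edges of D inside X would have odd degree only at u.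
  crossing-pair : ∀ {D X} → Decidable X → (∀ v → 2 ∣ deg G D v) →
                  ∀ {e} → e ∈ D → Crosses X e → ∃ λ f → f ∈ D × f ≢ e × Crosses X f
  crossing-pair {D} {X} X? even {e} e∈D e-crosses
    with any? (λ f → (f ∈? D) ×-dec ¬? (f ≟ e) ×-dec crosses? X? f)
  ... | yes found = found
  ... | no none with Crosses⁻ e-crosses
  ...   | u , x , e-ux , Xu , ¬Xx =
    ⊥-elim (2∤suc (deg-even {H} u even-away-from-u) (subst (2 ∣_) deg-D-u (even u)))
    where
    Inside? = λ f → (f ∈? D) ×-dec X? (end₁ f) ×-dec X? (end₂ f)
    H = select Inside?

    inside-ends : ∀ {f w} → f ∈ H → f ∈ inc G w → X w
    inside-ends f∈H f∈w with inc⁻ f∈w | ∈-select⁻ Inside? f∈H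
    ... | inj₁ refl | _ , X₁ , _ = X₁
    ... | inj₂ refl | _ , _ , X₂ = X₂

    H⊆D-e : H ⊆ D - e
    H⊆D-e f∈H = x∈p∧x≢y⇒x∈p-y (proj₁ (∈-select⁻ Inside? f∈H))
                               λ { refl → ¬Xx (inside-ends f∈H (Joins-inc₂ e-ux)) }

    D-e⊆H-at : ∀ {w f} → X w → f ∈ δ G (D - e) w → f ∈ δ G H w
    D-e⊆H-at {w} {f} Xw f∈ with ∈δ⁻ {D - e} f∈
    ... | f∈D-e , f∈w with Joins-from-inc f∈w
    ...   | z , f-wz with X? z
    ...     | no ¬Xz =
      contradiction (f , x∈p-y⇒x∈p {p = D} f∈D-e , x∈p-y⇒x≢y {p = D} f∈D-e , Crosses⁺ f-wz Xw ¬Xz) none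
    ...     | yes Xz = ∈δ⁺ (∈-select⁺ Inside? (x∈p-y⇒x∈p {p = D} f∈D-e , ends f-wz)) f∈w
      where
      ends : Joins f w z → X (end₁ f) × X (end₂ f)
      ends (inj₁ (refl , refl)) = Xw , Xz
      ends (inj₂ (refl , refl)) = Xz , Xw

    deg-H : ∀ {w} → X w → deg G H w ≡ deg G (D - e) w
    deg-H {w} Xw = cong ∣_∣ (⊆-antisym (δ-mono H⊆D-e) (D-e⊆H-at Xw))

    deg-D-u : deg G D u ≡ suc (deg G H u)
    deg-D-u = trans (deg-remove e∈D (Joins-inc₁ e-ux)) (cong suc (sym (deg-H Xu)))

    even-away-from-u : ∀ w → w ≢ u → 2 ∣ deg G H w
    even-away-from-u w w≢u with X? w
    ... | no ¬Xw = subst (2 ∣_) (sym (Empty⇒∣p∣≡0 λ { (f , f∈) → ¬Xw (uncurry inside-ends (∈δ⁻ {H} f∈)) })) (2 ∣0)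
    ... | yes Xw = subst (2 ∣_) (sym (trans (deg-H Xw) (deg-remove-nonincident {D} e∉w))) (even w)
      where
      e∉w : e ∉ inc G w
      e∉w e∈w with Joins-inc⁻ e-ux e∈w
      ... | inj₁ w≡u = w≢u w≡u
      ... | inj₂ refl = ¬Xx Xw

module Exploration {n m : ℕ} (G : Graph n m) where
  open Graph G
  open Incidence G
  open Crossing G

  -- tree only certifies ∣reached∣ ≤ 1 + ∣tree∣: each vertex other than a is found along its own edge.
  record Explored (F : EdgeSet m) (a : Fin n) : Set where
    field
      reached   : Subset n
      tree      : EdgeSet m
      source    : a ∈ reached
      reachable : ∀ {v} → v ∈ reached → Star (Adj G F) a v
      tree⊆F    : tree ⊆ F
      tree-ends : ∀ {f v} → f ∈ tree → f ∈ inc G v → v ∈ reached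
      size      : ∣ reached ∣ ≤ suc ∣ tree ∣

  open Explored

  extend : ∀ {F a} (s : Explored F a) {f} → f ∈ F → Crosses (_∈ reached s) f →
           Σ (Explored F a) λ s′ → ∣ reached s′ ∣ ≡ suc ∣ reached s ∣
  extend {F} {a} s {f} f∈F f-crosses with Crosses⁻ f-crosses
  ... | y , z , f-yz , y∈ , z∉ = s′ , ∣p∪⁅x⁆∣≡suc∣p∣ z∉
    where
    f∉tree : f ∉ tree s
    f∉tree f∈tree = z∉ (tree-ends s f∈tree (Joins-inc₂ f-yz))

    new-ends : ∀ {g v} → g ∈ tree s ⊎ g ≡ f → g ∈ inc G v → v ∈ reached s ∪ ⁅ z ⁆
    new-ends (inj₁ g∈tree) g∈v = x∈p∪⁅y⁆⁺ (inj₁ (tree-ends s g∈tree g∈v))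
    new-ends (inj₂ refl)   f∈v with Joins-inc⁻ f-yz f∈v
    ... | inj₁ refl = x∈p∪⁅y⁆⁺ (inj₁ y∈)
    ... | inj₂ refl = x∈p∪⁅y⁆⁺ (inj₂ refl)

    s′ : Explored F a
    s′ = record
      { reached   = reached s ∪ ⁅ z ⁆
      ; tree      = tree s ∪ ⁅ f ⁆
      ; source    = x∈p∪⁅y⁆⁺ (inj₁ (source s))
      ; reachable = λ v∈ → [ reachable s , (λ { refl → reachable s y∈ ◅◅ ((f , f∈F , f-yz) ◅ ε) }) ]′ (x∈p∪⁅y⁆⁻ v∈)
      ; tree⊆F    = λ g∈ → [ tree⊆F s , (λ { refl → f∈F }) ]′ (x∈p∪⁅y⁆⁻ g∈)
      ; tree-ends = λ g∈ → new-ends (x∈p∪⁅y⁆⁻ g∈)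
      ; size      = begin
          ∣ reached s ∪ ⁅ z ⁆ ∣ ≡⟨ ∣p∪⁅x⁆∣≡suc∣p∣ z∉ ⟩
          suc ∣ reached s ∣     ≤⟨ s≤s (size s) ⟩
          suc (suc ∣ tree s ∣)  ≡⟨ cong suc (∣p∪⁅x⁆∣≡suc∣p∣ f∉tree) ⟨
          suc ∣ tree s ∪ ⁅ f ⁆ ∣ ∎
      }
      where open ≤-Reasoning

  start : ∀ F a → Explored F a
  start F a = record
    { reached   = ⁅ a ⁆
    ; tree      = ∅
    ; source    = x∈⁅x⁆ a
    ; reachable = λ v∈ → subst (Star (Adj G F) a) (sym (x∈⁅y⁆⇒x≡y a v∈)) ε
    ; tree⊆F    = λ f∈ → contradiction f∈ ∉⊥
    ; tree-ends = λ f∈ → contradiction f∈ ∉⊥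
    ; size      = ≤-reflexive (trans (∣⁅x⁆∣≡1 a) (cong suc (sym (∣⊥∣≡0 m))))
    }

  Complete : ∀ {F a} → Explored F a → Set
  Complete {F} s = Closed F (_∈ reached s)

  -- Each extension adds a vertex, so k more steps suffice once n ≤ ∣reached∣ + k.
  explore-from : ∀ {F a} k (s : Explored F a) → n ≤ ∣ reached s ∣ + k → Σ (Explored F a) Complete
  explore-from {F} k s bound with any? (λ f → (f ∈? F) ×-dec crosses? (_∈? reached s) f)
  ... | no none = s , ¬Crosses⇒Closed (_∈? reached s) (λ f∈F f-crosses → none (_ , f∈F , f-crosses))
  ... | yes (f , f∈F , f-crosses) with extend s f∈F f-crosses | k
  ...   | s′ , grew | zero  = contradiction (∣p∣≤n (reached s′))
                                (<⇒≱ (subst (n <_) (sym grew) (s≤s (subst (n ≤_) (+-identityʳ _) bound))))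
  ...   | s′ , grew | suc k = explore-from k s′ (subst (n ≤_) (trans (+-suc _ k) (cong (_+ k) (sym grew))) bound)

  explore : ∀ F a → Σ (Explored F a) Complete
  explore F a = explore-from n (start F a) (m≤n+m n _)

module Components {n m : ℕ} (G : Graph n m) where
  open Graph G
  open Incidence G
  open Handshake G
  open Crossing G
  open Exploration G
  open Explored

  component : ∀ T a → VS G T a → Σ (EdgeSet m) λ P → InPaths G T P × VS G P a
  component T a a∈VT = P , (P⊆T , (f , f∈P) , connected , maximal) , VS⁺ f∈P f∈a
    where
    s = proj₁ (explore T a)
    closed = proj₂ (explore T a)
    X = reached s
    In? = λ f → (f ∈? T) ×-dec (end₁ f ∈? X)
    P = select In?

    P⊆T : P ⊆ T
    P⊆T = proj₁ ∘ ∈-select⁻ In?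

    ends-in-X : ∀ {f u v} → f ∈ T → u ∈ X → f ∈ inc G u → f ∈ inc G v → v ∈ X
    ends-in-X f∈T u∈X f∈u f∈v with Joins-from-inc f∈u
    ... | z , f-uz with Joins-inc⁻ f-uz f∈v
    ...   | inj₁ refl = u∈X
    ...   | inj₂ refl = closed f∈T f-uz u∈X

    P⁺ : ∀ {f u} → f ∈ T → f ∈ inc G u → u ∈ X → f ∈ P
    P⁺ f∈T f∈u u∈X = ∈-select⁺ In? (f∈T , ends-in-X f∈T u∈X f∈u (inc⁺ (inj₁ refl)))

    VP⊆X : ∀ {v} → VS G P v → v ∈ X
    VP⊆X v∈VP with VS⁻ v∈VP
    ... | f , f∈P , f∈v = ends-in-X (P⊆T f∈P) (proj₂ (∈-select⁻ In? f∈P)) (inc⁺ (inj₁ refl)) f∈v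

    f = proj₁ (VS⁻ a∈VT)
    f∈a = proj₂ (proj₂ (VS⁻ a∈VT))
    f∈P = P⁺ (proj₁ (proj₂ (VS⁻ a∈VT))) f∈a (source s)

    walk-in-P : ∀ {v} → v ∈ X → Star (Adj G P) a v
    walk-in-P v∈X = Star-restrict (_∈ X)
      (λ { y∈X (g , g∈T , g-yz) → closed g∈T g-yz y∈X , (g , P⁺ g∈T (Joins-inc₁ g-yz) y∈X , g-yz) })
      (source s) (reachable s v∈X)

    connected : Connected G P
    connected = connected-from (walk-in-P ∘ VP⊆X)

    maximal : ∀ e → e ∈ T → ∀ v → e ∈ inc G v → VS G P v → e ∈ P
    maximal e e∈T v e∈v v∈VP = P⁺ e∈T e∈v (VP⊆X v∈VP)

  VS? : ∀ F → Decidable (VS G F)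
  VS? F v = 1 ≤? deg G F v

  ∣V∣≤suc∣E∣ : ∀ {F a} → Connected G F → VS G F a → ∣ select (VS? F) ∣ ≤ suc ∣ F ∣
  ∣V∣≤suc∣E∣ {F} {a} connected a∈VF = begin
    ∣ select (VS? F) ∣ ≤⟨ p⊆q⇒∣p∣≤∣q∣ VF⊆X ⟩
    ∣ reached s ∣      ≤⟨ size s ⟩
    suc ∣ tree s ∣     ≤⟨ s≤s (p⊆q⇒∣p∣≤∣q∣ (tree⊆F s)) ⟩
    suc ∣ F ∣          ∎
    where
    open ≤-Reasoning
    s = proj₁ (explore F a)
    VF⊆X : select (VS? F) ⊆ reached s
    VF⊆X v∈ = Closed-Star (proj₂ (explore F a)) (source s) (connected a _ a∈VF (∈-select⁻ (VS? F) v∈))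

  leaf? : ∀ F → Decidable (V₁ G F)
  leaf? F v = deg G F v ≟ℕ 1

  -- 2∣E∣ + ∣leaves∣ = 2∣V∣ for a 2-matching, and ∣V∣ ≤ ∣E∣ + 1 for a connected one.
  no-three-leaves : ∀ {P a b c} → Connected G P → Is2Matching G P → V₁ G P a → V₁ G P b → V₁ G P c →
                    a ≢ b → a ≢ c → b ≢ c → ⊥
  no-three-leaves {P} {a} connected two-matching a-leaf b-leaf c-leaf a≢b a≢c b≢c =
    contradiction (+-cancelˡ-≤ (∣ P ∣ * 2) 3 2 (begin
      ∣ P ∣ * 2 + 3                         ≤⟨ +-monoʳ-≤ (∣ P ∣ * 2) three-leaves ⟩
      ∣ P ∣ * 2 + ∣ select (leaf? P) ∣      ≡⟨ count ⟩
      ∣ select (VS? P) ∣ * 2                ≤⟨ *-monoˡ-≤ 2 (∣V∣≤suc∣E∣ connected (≤-reflexive (sym a-leaf))) ⟩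
      suc ∣ P ∣ * 2                         ≡⟨ +-comm 2 (∣ P ∣ * 2) ⟩
      ∣ P ∣ * 2 + 2                         ∎)) (λ { (s≤s (s≤s ())) })
    where
    open ≤-Reasoning
    three-leaves : 3 ≤ ∣ select (leaf? P) ∣
    three-leaves = 3≤∣p∣ (∈-select⁺ (leaf? P) a-leaf) (∈-select⁺ (leaf? P) b-leaf) (∈-select⁺ (leaf? P) c-leaf) a≢b a≢c b≢c

    pointwise : ∀ d → d ≤ 2 → d + 𝟙 (does (d ≟ℕ 1)) ≡ 𝟙 (does (1 ≤? d)) * 2
    pointwise 0 _ = refl
    pointwise 1 _ = refl
    pointwise 2 _ = refl
    pointwise (suc (suc (suc _))) (s≤s (s≤s ()))

    count : ∣ P ∣ * 2 + ∣ select (leaf? P) ∣ ≡ ∣ select (VS? P) ∣ * 2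
    count = begin-equality
      ∣ P ∣ * 2 + ∣ select (leaf? P) ∣
        ≡⟨ cong₂ _+_ (sym (handshake P)) (∣select∣≡∑𝟙 (leaf? P)) ⟩
      sum (deg G P) + sum (λ v → 𝟙 (does (leaf? P v)))
        ≡⟨ ∑-distrib-+ (deg G P) (λ v → 𝟙 (does (leaf? P v))) ⟨
      sum (λ v → deg G P v + 𝟙 (does (leaf? P v)))
        ≡⟨ sum-cong-≗ (λ v → pointwise (deg G P v) (two-matching v)) ⟩
      sum (λ v → 𝟙 (does (VS? P v)) * 2)
        ≡⟨ *-distribʳ-sum 2 (λ v → 𝟙 (does (VS? P v))) ⟨
      sum (λ v → 𝟙 (does (VS? P v))) * 2
        ≡⟨ cong (_* 2) (∣select∣≡∑𝟙 (VS? P)) ⟨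
      ∣ select (VS? P) ∣ * 2 ∎

module Validity {n m : ℕ} (G : Graph n m) where
  Agreement : EdgeSet m → EdgeSet m → Set
  Agreement S T = ∀ v → V₂ G S v → V₂ G T v → δ G S v ≡ δ G T v

  Separated : EdgeSet m → EdgeSet m → Set
  Separated S T = ∀ C → C ⊆ S → IsCycle G C → ∀ P → InPaths G T P → ¬ (VS G C ≐ VS G P)

module Transfer {n m : ℕ} (G : Graph n m) {S T : EdgeSet m} {e : Fin m}
                (e∈S : e ∈ S) (e∉T : e ∉ T)
                (S-deg : ∀ {v} → e ∈ inc G v → deg G S v ≡ 2)
                (T-deg : ∀ {v} → e ∈ inc G v → deg G T v ≡ 1) where
  open Incidence G
  open Validity G

  S′ T′ : EdgeSet m
  S′ = S - e
  T′ = T ∪ ⁅ e ⁆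

  S′-deg : ∀ {v} → e ∈ inc G v → deg G S′ v ≡ 1
  S′-deg e∈v = suc-injective (trans (sym (deg-remove e∈S e∈v)) (S-deg e∈v))

  T′-deg : ∀ {v} → e ∈ inc G v → deg G T′ v ≡ 2
  T′-deg e∈v = trans (deg-insert e∉T e∈v) (cong suc (T-deg e∈v))

  S′⊆S : S′ ⊆ S
  S′⊆S = p─q⊆p S ⁅ e ⁆

  T⊆T′ : T ⊆ T′
  T⊆T′ = p⊆p∪q ⁅ e ⁆

  spanning-S′ : Spanning G S → Spanning G S′
  spanning-S′ spanning v with e ∈? inc G v
  ... | yes e∈v = ≤-reflexive (sym (S′-deg e∈v))
  ... | no  e∉v = subst (1 ≤_) (sym (deg-remove-nonincident {S} e∉v)) (spanning v)

  2-matching-T′ : Is2Matching G T → Is2Matching G T′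
  2-matching-T′ two-matching v with e ∈? inc G v
  ... | yes e∈v = ≤-reflexive (T′-deg e∈v)
  ... | no  e∉v = subst (_≤ 2) (sym (deg-insert-nonincident {T} e∉v)) (two-matching v)

  agreement′ : Agreement S T → Agreement S′ T′
  agreement′ agree v S′-two T′-two with e ∈? inc G v
  ... | yes e∈v = contradiction (trans (sym (S′-deg e∈v)) S′-two) λ ()
  ... | no  e∉v = begin
    δ G S′ v ≡⟨ δ-unchanged e∉v (λ _ → S′⊆S) (λ f≢e f∈S → x∈p∧x≢y⇒x∈p-y f∈S f≢e) ⟩
    δ G S v  ≡⟨ agree v (trans (sym (deg-remove-nonincident {S} e∉v)) S′-two)
                        (trans (sym (deg-insert-nonincident {T} e∉v)) T′-two) ⟩
    δ G T v  ≡⟨ δ-unchanged e∉v (λ _ → T⊆T′) (λ f≢e f∈T′ → x∈p∪⁅y⁆∧x≢y⇒x∈p {p = T} f∈T′ f≢e) ⟩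
    δ G T′ v ∎
    where open ≡-Reasoning

  InPaths-T′⇒T : ∀ {P} → InPaths G T′ P → e ∉ P → InPaths G T P
  InPaths-T′⇒T (P⊆T′ , nonempty , connected , maximal) e∉P =
      (λ f∈P → x∈p∪⁅y⁆∧x≢y⇒x∈p (P⊆T′ f∈P) λ { refl → e∉P f∈P })
    , nonempty , connected , (λ f f∈T → maximal f (T⊆T′ f∈T))

  separated′ : Separated S T → Separated S′ T′
  separated′ separated C C⊆S′ C-cycle P P-component VC≐VP with e ∈? P
  ... | no e∉P = separated C (S′⊆S ∘ C⊆S′) C-cycle P (InPaths-T′⇒T P-component e∉P) VC≐VP
  ... | yes e∈P = contradiction (subst (_≤ 1) C-two (subst (deg G C u ≤_) (S′-deg e∈u) (deg-mono u C⊆S′))) λ { (s≤s ()) }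
    where
    -- the ends of e have degree 1 in S′, too small to lie on a cycle of S′
    u = Graph.end₁ G e
    e∈u = inc⁺ (inj₁ refl)
    C-two : deg G C u ≡ 2
    C-two = proj₂ (proj₂ C-cycle) u (proj₂ (VC≐VP u) (VS⁺ e∈P e∈u))

  valid′ : Valid G S T → Acyclic G T′ → Valid G S′ T′
  valid′ ((S-spanning , S-2-matching) , (T-spanning , T-2-matching) , _ , agree , separated) T′-acyclic =
      (spanning-S′ S-spanning , (λ v → ≤-trans (deg-mono v S′⊆S) (S-2-matching v)))
    , ((λ v → ≤-trans (T-spanning v) (deg-mono v T⊆T′)) , 2-matching-T′ T-2-matching)
    , T′-acyclic , agreement′ agree , separated′ separated

  -- The ends of e switch from (2 in S, 1 in T) to (1 in S′, 2 in T′); other degrees are unchanged.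
  V₁-∪ : (λ v → V₁ G S′ v ⊎ V₁ G T′ v) ≐ (λ v → V₁ G S v ⊎ V₁ G T v)
  V₁-∪ v with e ∈? inc G v
  ... | yes e∈v = (λ _ → inj₂ (T-deg e∈v)) , (λ _ → inj₁ (S′-deg e∈v))
  ... | no  e∉v rewrite deg-remove-nonincident {S} e∉v | deg-insert-nonincident {T} e∉v = (λ x → x) , (λ x → x)

  V₁-∩ : (λ v → V₁ G S′ v × V₁ G T′ v) ≐ (λ v → V₁ G S v × V₁ G T v)
  V₁-∩ v with e ∈? inc G v
  ... | yes e∈v = (λ (_ , T′-one) → contradiction (trans (sym (T′-deg e∈v)) T′-one) λ ())
                , (λ (S-one , _) → contradiction (trans (sym (S-deg e∈v)) S-one) λ ())
  ... | no  e∉v rewrite deg-remove-nonincident {S} e∉v | deg-insert-nonincident {T} e∉v = (λ x → x) , (λ x → x)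

module Main {n m : ℕ} (G : Graph n m) (S T : EdgeSet m) (valid : Valid G S T)
            (C : EdgeSet m) (C⊆S : C ⊆ S) (C-cycle : IsCycle G C) where
  open Graph G
  open Incidence G
  open Handshake G
  open Crossing G
  open Components G
  open Validity G

  S-2-matching : Is2Matching G S
  S-2-matching = proj₂ (proj₁ valid)

  T-spanning : Spanning G T
  T-spanning = proj₁ (proj₁ (proj₂ valid))

  T-2-matching : Is2Matching G T
  T-2-matching = proj₂ (proj₁ (proj₂ valid))

  T-acyclic : Acyclic G T
  T-acyclic = proj₁ (proj₂ (proj₂ valid))

  agree : Agreement S T
  agree = proj₁ (proj₂ (proj₂ (proj₂ valid)))

  separated : Separated S T
  separated = proj₂ (proj₂ (proj₂ (proj₂ valid)))

  C-connected : Connected G C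
  C-connected = proj₁ (proj₂ C-cycle)

  C-regular : ∀ v → VS G C v → V₂ G C v
  C-regular = proj₂ (proj₂ C-cycle)

  S-deg-on-C : ∀ {v} → VS G C v → deg G S v ≡ 2
  S-deg-on-C {v} v∈VC = ≤-antisym (S-2-matching v) (subst (_≤ deg G S v) (C-regular v v∈VC) (deg-mono v C⊆S))

  δC≡δT : ∀ {v} → VS G C v → V₂ G T v → δ G C v ≡ δ G T v
  δC≡δT {v} v∈VC T-two = trans δC≡δS (agree v (S-deg-on-C v∈VC) T-two)
    where
    δC≡δS : δ G C v ≡ δ G S v
    δC≡δS = ⊆-antisym (δ-mono C⊆S)
      (p⊆q∧∣q∣≤∣p∣⇒q⊆p (δ-mono C⊆S) (≤-reflexive (trans (S-deg-on-C v∈VC) (sym (C-regular v v∈VC)))))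

  T-deg-1-or-2 : ∀ v → V₁ G T v ⊎ V₂ G T v
  T-deg-1-or-2 v with deg G T v ≟ℕ 2
  ... | yes two = inj₂ two
  ... | no  ≢2  = inj₁ (≤-antisym (≤-pred (≤∧≢⇒< (T-2-matching v) ≢2)) (T-spanning v))

  T-deg-at-C∖T : ∀ {f v} → f ∈ C → f ∉ T → f ∈ inc G v → V₁ G T v
  T-deg-at-C∖T {f} {v} f∈C f∉T f∈v with T-deg-1-or-2 v
  ... | inj₁ one = one
  ... | inj₂ two = contradiction (proj₁ (∈δ⁻ {T} (subst (f ∈_) (δC≡δT (VS⁺ f∈C f∈v) two) (∈δ⁺ f∈C f∈v)))) f∉T

  e₀-spec : ∃ λ e₀ → e₀ ∈ C × e₀ ∉ T
  e₀-spec = p⊈q⇒∃∉ (λ C⊆T → T-acyclic C C⊆T C-cycle)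

  e₀ : Fin m
  e₀ = proj₁ e₀-spec

  e₀∈C : e₀ ∈ C
  e₀∈C = proj₁ (proj₂ e₀-spec)

  e₀∉T : e₀ ∉ T
  e₀∉T = proj₂ (proj₂ e₀-spec)

  a : Fin n
  a = end₁ e₀

  a∈VC : VS G C a
  a∈VC = VS⁺ e₀∈C (inc⁺ (inj₁ refl))

  P-spec : Σ (EdgeSet m) λ P → InPaths G T P × VS G P a
  P-spec = component T a (T-spanning a)

  P : EdgeSet m
  P = proj₁ P-spec

  P-component : InPaths G T P
  P-component = proj₁ (proj₂ P-spec)

  a∈VP : VS G P a
  a∈VP = proj₂ (proj₂ P-spec)

  P⊆T : P ⊆ T
  P⊆T = proj₁ P-component

  P-connected : Connected G P
  P-connected = proj₁ (proj₂ (proj₂ P-component))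

  P-maximal : ∀ f → f ∈ T → ∀ v → f ∈ inc G v → VS G P v → f ∈ P
  P-maximal = proj₂ (proj₂ (proj₂ P-component))

  P-2-matching : Is2Matching G P
  P-2-matching v = ≤-trans (deg-mono v P⊆T) (T-2-matching v)

  P-deg≡T-deg : ∀ {v} → VS G P v → deg G P v ≡ deg G T v
  P-deg≡T-deg {v} v∈VP = cong ∣_∣ (⊆-antisym (δ-mono P⊆T)
    (λ f∈ → let f∈T , f∈v = ∈δ⁻ {T} f∈ in ∈δ⁺ (P-maximal _ f∈T v f∈v v∈VP) f∈v))

  T-edge-¬crosses : ∀ {f} → f ∈ T → ¬ Crosses (VS G P) f
  T-edge-¬crosses {f} f∈T f-crosses with Crosses⁻ f-crosses
  ... | u , x , f-ux , u∈VP , x∉VP = x∉VP (VS⁺ (P-maximal f f∈T u (Joins-inc₁ f-ux) u∈VP) (Joins-inc₂ f-ux))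

  module Boundary {e} (e∈C : e ∈ C) (e-crosses : Crosses (VS G P) e) where
    e∉T : e ∉ T
    e∉T e∈T = T-edge-¬crosses e∈T e-crosses

    open Transfer G (C⊆S e∈C) e∉T (S-deg-on-C ∘ VS⁺ e∈C) (T-deg-at-C∖T e∈C e∉T) public

    T′-acyclic : Acyclic G T′
    T′-acyclic D D⊆T′ D-cycle with e ∈? D
    ... | no  e∉D = T-acyclic D (λ f∈D → x∈p∪⁅y⁆∧x≢y⇒x∈p (D⊆T′ f∈D) λ { refl → e∉D f∈D }) D-cycle
    ... | yes e∈D with crossing-pair (VS? P) (cycle-even D-cycle) e∈D e-crosses
    ...   | f , f∈D , f≢e , f-crosses = T-edge-¬crosses (x∈p∪⁅y⁆∧x≢y⇒x∈p (D⊆T′ f∈D) f≢e) f-crosses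

    valid-after : Valid G S′ T′
    valid-after = valid′ valid T′-acyclic

    P∪e⊆T′ : P ∪ ⁅ e ⁆ ⊆ T′
    P∪e⊆T′ f∈ = [ x∈p∪⁅y⁆⁺ ∘ inj₁ ∘ P⊆T , x∈p∪⁅y⁆⁺ ∘ inj₂ ]′ (x∈p∪⁅y⁆⁻ f∈)

    walk-from : ∀ {u x} → Joins e u x → VS G P u → ∀ {w} → VS G (P ∪ ⁅ e ⁆) w → Star (Adj G (P ∪ ⁅ e ⁆)) u w
    walk-from {u} e-ux u∈VP w∈ with VS⁻ w∈
    ... | f , f∈ , f∈w with x∈p∪⁅y⁆⁻ {p = P} {y = e} f∈
    ...   | inj₁ f∈P = Star.map (Adj-mono (x∈p∪⁅y⁆⁺ ∘ inj₁)) (P-connected u _ u∈VP (VS⁺ f∈P f∈w))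
    ...   | inj₂ refl with Joins-inc⁻ e-ux f∈w
    ...     | inj₁ refl = ε
    ...     | inj₂ refl = (e , f∈ , e-ux) ◅ ε

    P∪e-path : IsPath G (P ∪ ⁅ e ⁆)
    P∪e-path with Crosses⁻ e-crosses
    ... | _ , _ , e-ux , u∈VP , _ =
        (e , x∈p∪⁅y⁆⁺ (inj₂ refl))
      , connected-from (walk-from e-ux u∈VP)
      , (λ D D⊆ → T′-acyclic D (P∪e⊆T′ ∘ D⊆))
      , (λ v → ≤-trans (deg-mono v P∪e⊆T′) (2-matching-T′ T-2-matching v))

  module C-inside-P (C-closed : Closed C (VS G P)) where
    VC⊆VP : ∀ {v} → VS G C v → VS G P v
    VC⊆VP v∈VC = Closed-Star C-closed a∈VP (C-connected a _ a∈VC v∈VC)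

    leaf : ∀ {f v} → f ∈ C → f ∉ T → f ∈ inc G v → V₁ G P v
    leaf f∈C f∉T f∈v = trans (P-deg≡T-deg (VC⊆VP (VS⁺ f∈C f∈v))) (T-deg-at-C∖T f∈C f∉T f∈v)

    -- Both ends of e₀ and a new end of f would be three leaves of the path P.
    one-edge-outside-T : ∀ {f} → f ∈ C → f ≢ e₀ → f ∉ T → ⊥
    one-edge-outside-T f∈C f≢e₀ f∉T with distinct-edge-new-end {e₀} (inj₁ (refl , refl)) f≢e₀
    ... | w , f∈w , w≢a , w≢b =
      no-three-leaves P-connected P-2-matching
        (leaf e₀∈C e₀∉T (inc⁺ (inj₁ refl))) (leaf e₀∈C e₀∉T (inc⁺ (inj₂ refl))) (leaf f∈C f∉T f∈w)
        (loopless e₀) (w≢a ∘ sym) (w≢b ∘ sym)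

    C∖e₀⊆T⇒VC≐VP : (∀ {f} → f ∈ C → f ≢ e₀ → f ∈ T) → VS G C ≐ VS G P
    C∖e₀⊆T⇒VC≐VP C∖e₀⊆T v = VC⊆VP , Star-pres (VS G C) step a∈VC ∘ P-connected a v a∈VP
      where
      P-edge-in-C : ∀ {f y} → VS G C y → f ∈ T → f ∈ inc G y → f ∈ C
      P-edge-in-C {f} {y} y∈VC f∈T f∈y with T-deg-1-or-2 y
      ... | inj₂ two = proj₁ (∈δ⁻ {C} (subst (f ∈_) (sym (δC≡δT y∈VC two)) (∈δ⁺ f∈T f∈y)))
      ... | inj₁ one with ∣p∣≡2⇒∃≢ (C-regular y y∈VC) e₀
      ...   | g , g∈δ , g≢e₀ = let g∈C , g∈y = ∈δ⁻ {C} g∈δ in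
        subst (_∈ C) (∣p∣≡1⇒x≡y one (∈δ⁺ (C∖e₀⊆T g∈C g≢e₀) g∈y) (∈δ⁺ f∈T f∈y)) g∈C
      step : ∀ {y z} → VS G C y → Adj G P y z → VS G C z
      step y∈VC (f , f∈P , f-yz) = VS⁺ (P-edge-in-C y∈VC (P⊆T f∈P) (Joins-inc₁ f-yz)) (Joins-inc₂ f-yz)

    absurd : ⊥
    absurd with any? (λ f → (f ∈? C) ×-dec ¬? (f ≟ e₀) ×-dec ¬? (f ∈? T))
    ... | yes (f , f∈C , f≢e₀ , f∉T) = one-edge-outside-T f∈C f≢e₀ f∉T
    ... | no none = separated C C⊆S C-cycle P P-component (C∖e₀⊆T⇒VC≐VP C∖e₀⊆T)
      where
      C∖e₀⊆T : ∀ {f} → f ∈ C → f ≢ e₀ → f ∈ T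
      C∖e₀⊆T {f} f∈C f≢e₀ = decidable-stable (f ∈? T) λ f∉T → none (f , f∈C , f≢e₀ , f∉T)

  boundary-edge : ∃ λ e → e ∈ C × Crosses (VS G P) e
  boundary-edge with any? (λ f → (f ∈? C) ×-dec crosses? (VS? P) f)
  ... | yes found = found
  ... | no none = ⊥-elim (C-inside-P.absurd (¬Crosses⇒Closed (VS? P) λ f∈C f-crosses → none (_ , f∈C , f-crosses)))

  boundary-pair : Σ (Fin m) λ e₁ → Σ (Fin m) λ e₂ →
                  (e₁ ∈ C × Crosses (VS G P) e₁) × (e₂ ∈ C × Crosses (VS G P) e₂) × e₁ ≢ e₂
  boundary-pair with boundary-edge
  ... | e₁ , e₁∈C , e₁-crosses with crossing-pair (VS? P) (cycle-even C-cycle) e₁∈C e₁-crosses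
  ...   | e₂ , e₂∈C , e₂≢e₁ , e₂-crosses =
    e₁ , e₂ , (e₁∈C , e₁-crosses) , (e₂∈C , e₂-crosses) , e₂≢e₁ ∘ sym

lemma2 : ∀ {n m} (G : Graph n m) (S T : EdgeSet m) → Valid G S T →
    ∀ (C : EdgeSet m) → C ⊆ S → IsCycle G C →
    Σ (Fin m) λ e₁ → Σ (Fin m) λ e₂ →
      e₁ ∈ C × e₂ ∈ C × e₁ ≢ e₂
      × Valid G (S - e₁) (T ∪ ⁅ e₁ ⁆)
      × Valid G (S - e₂) (T ∪ ⁅ e₂ ⁆)
      × ((λ v → V₁ G (S - e₁) v ⊎ V₁ G (T ∪ ⁅ e₁ ⁆) v) ≐ (λ v → V₁ G S v ⊎ V₁ G T v))
      × ((λ v → V₁ G (S - e₁) v × V₁ G (T ∪ ⁅ e₁ ⁆) v) ≐ (λ v → V₁ G S v × V₁ G T v))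
      × ((λ v → V₁ G (S - e₂) v ⊎ V₁ G (T ∪ ⁅ e₂ ⁆) v) ≐ (λ v → V₁ G S v ⊎ V₁ G T v))
      × ((λ v → V₁ G (S - e₂) v × V₁ G (T ∪ ⁅ e₂ ⁆) v) ≐ (λ v → V₁ G S v × V₁ G T v))
      × (Σ (EdgeSet m) λ P → InPaths G T P
           × IsPath G (P ∪ ⁅ e₁ ⁆) × IsPath G (P ∪ ⁅ e₂ ⁆))
lemma2 G S T valid C C⊆S C-cycle with Main.boundary-pair G S T valid C C⊆S C-cycle
... | e₁ , e₂ , (e₁∈C , e₁-crosses) , (e₂∈C , e₂-crosses) , e₁≢e₂ =
    e₁ , e₂ , e₁∈C , e₂∈C , e₁≢e₂
  , E₁.valid-after , E₂.valid-after
  , E₁.V₁-∪ , E₁.V₁-∩ , E₂.V₁-∪ , E₂.V₁-∩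
  , P , P-component , E₁.P∪e-path , E₂.P∪e-path
  where
  open Main G S T valid C C⊆S C-cycle
  module E₁ = Boundary e₁∈C e₁-crosses
  module E₂ = Boundary e₂∈C e₂-crosses
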